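{- Let $\Delta>1$ be an odd integer and let $H$ be the gadget graph defined below. Then $H$ has a maximum independent set $I$ of size $(\Delta-1)^2/2 + (\Delta-1)/2$ such that $h \notin I$.
   Context: The gadget $H$ (for odd $\Delta>1$) is constructed as follows. Take $(\Delta-1)/2$ vertex-disjoint complete bipartite graphs $K_1,\dots,K_{(\Delta-1)/2}$, where $K_i$ has bipartition classes $A_i,B_i$, each of size $\Delta-1$. Add $\Delta-1$ new vertices $a_1,\dots,a_{(\Delta-1)/2},b_1,\dots,b_{(\Delta-1)/2}$, and for each $i$ join $a_i$ to every vertex of $A_i$ and $b_i$ to every vertex of $B_i$. Finally add a new vertex $h$ adjacent to all $a_i$ and all $b_i$. (Every vertex except $h$ has degree $\Delta$; $h$ has degree $\Delta-1$.) An independent set is a set of pairwise non-adjacent vertices; a maximum independent set is one of largest size. -}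

module Defs where

open import Data.Nat using (ℕ; _∸_; _≤_)
open import Data.Nat.DivMod using (_/_)
open import Data.Fin using (Fin)
open import Data.List using (List; length)
open import Data.List.Membership.Propositional using (_∈_)
open import Data.List.Relation.Unary.Unique.Propositional using (Unique)
open import Data.Sum using (_⊎_)
open import Data.Product using (_×_)
open import Relation.Nullary using (¬_)

-- Number of complete bipartite blocks: (Δ-1)/2.
blocks : ℕ → ℕ
blocks Δ = (Δ ∸ 1) / 2

data V (Δ : ℕ) : Set where
  vA : Fin (blocks Δ) → Fin (Δ ∸ 1) → V Δ
  vB : Fin (blocks Δ) → Fin (Δ ∸ 1) → V Δ
  va : Fin (blocks Δ) → V Δ
  vb : Fin (blocks Δ) → V Δ
  vh : V Δ

-- Oriented edge list of H (each undirected edge listed once).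
data Edge (Δ : ℕ) : V Δ → V Δ → Set where
  eAB : ∀ i j j' → Edge Δ (vA i j) (vB i j')
  eaA : ∀ i j → Edge Δ (va i) (vA i j)
  ebB : ∀ i j → Edge Δ (vb i) (vB i j)
  eha : ∀ i → Edge Δ vh (va i)
  ehb : ∀ i → Edge Δ vh (vb i)

Adj : (Δ : ℕ) → V Δ → V Δ → Set
Adj Δ u v = Edge Δ u v ⊎ Edge Δ v u

-- A (finite) vertex set is a duplicate-free list; independent = pairwise non-adjacent.
IsIndependent : (Δ : ℕ) → List (V Δ) → Set
IsIndependent Δ I = Unique I × (∀ {u v} → u ∈ I → v ∈ I → ¬ Adj Δ u v)

IsMaxIndependent : (Δ : ℕ) → List (V Δ) → Set
IsMaxIndependent Δ I =
  IsIndependent Δ I × (∀ (J : List (V Δ)) → IsIndependent Δ J → length J ≤ length I)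

{-# OPTIONS --safe #-}
-- The sets A_i together with the b_i form an independent set of size ((Δ-1)/2)·Δ: they are the
-- complement of the vertex cover formed by the B_i, the a_i and h. It is maximum because the
-- vertices of H split into ((Δ-1)/2)·Δ classes, each meeting a given independent set J at most
-- once. If h ∈ J, pair a_i with b_i (both are neighbours of h) and A_i j with B_i j; if h ∉ J,
-- pair a_i with a vertex of A_i, b_i with a vertex of B_i, and the rest of A_i with the rest of
-- B_i, putting h into any class.
module Submission where

open import Defs
open import Data.Bool using (Bool; true; false; T)
open import Data.Empty using (⊥-elim)
open import Data.Fin using (Fin; zero; suc; fromℕ; fromℕ<; inject₁; combine; remQuot)
import Data.Fin as Fin
import Data.Fin.Properties as Finₚ
open import Data.List using (List; _∷_; length; lookup; tabulate)
open import Data.List.Membership.Propositional using (_∈_; _∉_)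
open import Data.List.Membership.Propositional.Properties using (∈-lookup; ∈-tabulate⁻)
open import Data.List.Properties using (length-tabulate)
import Data.List.Relation.Unary.All as All
open import Data.List.Relation.Unary.AllPairs using (_∷_)
open import Data.List.Relation.Unary.Any using (any?)
open import Data.List.Relation.Unary.Unique.Propositional using (Unique)
open import Data.List.Relation.Unary.Unique.Propositional.Properties using (tabulate⁺)
open import Data.Nat using (ℕ; suc; _∸_; _+_; _*_; _<_; _≤_; NonZero)
import Data.Nat as ℕ
open import Data.Nat.DivMod using (_/_; _%_; m≡m%n+[m/n]*n; m*n/n≡m)
import Data.Nat.Properties as ℕₚ
open import Data.Product using (Σ; _×_; _,_; uncurry)
open import Data.Product.Properties using (,-injectiveˡ; ,-injectiveʳ)
open import Data.Sum using (_⊎_; inj₁; inj₂; [_,_])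
open import Data.Unit using (tt)
open import Function using (_∘_)
open import Relation.Nullary using (¬_; Dec; yes; no; contradiction)
open import Relation.Binary.PropositionalEquality
  using (_≡_; _≢_; refl; sym; trans; cong; cong₂; subst; module ≡-Reasoning)

Unique⇒lookup-distinct : ∀ {A : Set} (xs : List A) → Unique xs →
  ∀ {i j : Fin (length xs)} → i Fin.< j → lookup xs i ≢ lookup xs j
Unique⇒lookup-distinct (x ∷ xs) (x∉xs ∷ _) {zero} {suc j} _ = All.lookup x∉xs (∈-lookup j)
Unique⇒lookup-distinct (x ∷ xs) (_ ∷ uniq) {suc i} {suc j} (ℕ.s≤s i<j) =
  Unique⇒lookup-distinct xs uniq i<j

length≤-injectiveOn : ∀ {A : Set} {m} (f : A → Fin m) {xs : List A} → Unique xs →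
  (∀ {x y} → x ∈ xs → y ∈ xs → f x ≡ f y → x ≡ y) → length xs ≤ m
length≤-injectiveOn {m = m} f {xs} uniq inj with m ℕ.<? length xs
... | no m≮len = ℕₚ.≮⇒≥ m≮len
... | yes m<len with i , j , i<j , fi≡fj ← Finₚ.pigeonhole m<len (f ∘ lookup xs) =
  contradiction (inj (∈-lookup i) (∈-lookup j) fi≡fj) (Unique⇒lookup-distinct xs uniq i<j)

remQuot-injective : ∀ {m} n {x y : Fin (m * n)} → remQuot {m} n x ≡ remQuot n y → x ≡ y
remQuot-injective {m} n {x} {y} eq = begin
  x                                  ≡⟨ Finₚ.combine-remQuot {m} n x ⟨
  uncurry combine (remQuot {m} n x)  ≡⟨ cong (uncurry combine) eq ⟩
  uncurry combine (remQuot {m} n y)  ≡⟨ Finₚ.combine-remQuot {m} n y ⟩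
  y                                  ∎
  where open ≡-Reasoning

zero≢fromℕ : ∀ n .{{_ : NonZero n}} → zero ≢ fromℕ n
zero≢fromℕ (suc _) ()

odd⇒pred≡blocks*2 : ∀ Δ → Δ % 2 ≡ 1 → Δ ∸ 1 ≡ blocks Δ * 2
odd⇒pred≡blocks*2 Δ odd = trans pred≡half*2 (cong (_* 2) (sym blocks≡half))
  where
  pred≡half*2 : Δ ∸ 1 ≡ Δ / 2 * 2
  pred≡half*2 = cong (_∸ 1) (trans (m≡m%n+[m/n]*n Δ 2) (cong (_+ Δ / 2 * 2) odd))
  blocks≡half : blocks Δ ≡ Δ / 2
  blocks≡half = trans (cong (_/ 2) pred≡half*2) (m*n/n≡m (Δ / 2) 2)

n≡m*2⇒m*[1+n]≡n*n/2+n/2 : ∀ m n → n ≡ m * 2 → m * suc n ≡ n * n / 2 + n / 2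
n≡m*2⇒m*[1+n]≡n*n/2+n/2 m _ refl = begin
  m * suc (m * 2)                  ≡⟨ ℕₚ.*-suc m (m * 2) ⟩
  m + m * (m * 2)                  ≡⟨ ℕₚ.+-comm m _ ⟩
  m * (m * 2) + m                  ≡⟨ cong₂ _+_ (m*n/n≡m _ 2) (m*n/n≡m m 2) ⟨
  m * (m * 2) * 2 / 2 + m * 2 / 2  ≡⟨ cong (λ x → x / 2 + m * 2 / 2) square ⟩
  m * 2 * (m * 2) / 2 + m * 2 / 2  ∎
  where
  open ≡-Reasoning
  square : m * (m * 2) * 2 ≡ m * 2 * (m * 2)
  square = begin
    m * (m * 2) * 2    ≡⟨ ℕₚ.*-assoc m (m * 2) 2 ⟩
    m * (m * 2 * 2)    ≡⟨ cong (m *_) (ℕₚ.*-comm (m * 2) 2) ⟩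
    m * (2 * (m * 2))  ≡⟨ ℕₚ.*-assoc m 2 (m * 2) ⟨
    m * 2 * (m * 2)    ∎

module Gadget (Δ : ℕ) where

  inCover : V Δ → Bool
  inCover (vA _ _) = false
  inCover (vB _ _) = true
  inCover (va _) = true
  inCover (vb _) = false
  inCover vh = true

  edge-covered : ∀ {u v} → Edge Δ u v → T (inCover u) ⊎ T (inCover v)
  edge-covered (eAB _ _ _) = inj₂ tt
  edge-covered (eaA _ _) = inj₁ tt
  edge-covered (ebB _ _) = inj₂ tt
  edge-covered (eha _) = inj₁ tt
  edge-covered (ehb _) = inj₁ tt

  uncovered⇒nonadjacent : ∀ {u v} → ¬ T (inCover u) → ¬ T (inCover v) → ¬ Adj Δ u v
  uncovered⇒nonadjacent ¬u ¬v (inj₁ e) = [ ¬u , ¬v ] (edge-covered e)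
  uncovered⇒nonadjacent ¬u ¬v (inj₂ e) = [ ¬v , ¬u ] (edge-covered e)

  witnessVertex : Fin (blocks Δ) → Fin (suc (Δ ∸ 1)) → V Δ
  witnessVertex i zero = vb i
  witnessVertex i (suc j) = vA i j

  witnessVertex-injective : ∀ {i j i′ j′} → witnessVertex i j ≡ witnessVertex i′ j′ → (i , j) ≡ (i′ , j′)
  witnessVertex-injective {j = zero} {j′ = zero} refl = refl
  witnessVertex-injective {j = suc _} {j′ = suc _} refl = refl

  witnessVertex-uncovered : ∀ i j → ¬ T (inCover (witnessVertex i j))
  witnessVertex-uncovered i zero ()
  witnessVertex-uncovered i (suc j) ()

  witness : List (V Δ)
  witness = tabulate (uncurry witnessVertex ∘ remQuot (suc (Δ ∸ 1)))

  witness-uncovered : ∀ {u} → u ∈ witness → ¬ T (inCover u)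
  witness-uncovered u∈I with x , refl ← ∈-tabulate⁻ u∈I = uncurry witnessVertex-uncovered _

  witness-independent : IsIndependent Δ witness
  witness-independent =
    tabulate⁺ (remQuot-injective _ ∘ witnessVertex-injective) ,
    λ u∈I v∈I → uncovered⇒nonadjacent (witness-uncovered u∈I) (witness-uncovered v∈I)

  length-witness : length witness ≡ blocks Δ * suc (Δ ∸ 1)
  length-witness = length-tabulate _

  vh∉witness : vh ∉ witness
  vh∉witness vh∈I = witness-uncovered vh∈I tt

  CliqueCoverOutside : (V Δ → Set) → {C : Set} → (V Δ → C) → Set
  CliqueCoverOutside X c = ∀ u v → c u ≡ c v → u ≡ v ⊎ Adj Δ u v ⊎ X u ⊎ X v

  independent-length≤ : ∀ {X b s} {c : V Δ → Fin b × Fin s} → CliqueCoverOutside X c →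
    ∀ {J} → IsIndependent Δ J → (∀ {u} → u ∈ J → ¬ X u) → length J ≤ b * s
  independent-length≤ {c = c} cover (uniq , indep) avoid =
    length≤-injectiveOn (uncurry combine ∘ c) uniq injective
    where
    injective : ∀ {u v} → u ∈ _ → v ∈ _ → uncurry combine (c u) ≡ uncurry combine (c v) → u ≡ v
    injective {u} {v} u∈J v∈J eq
      with cover u v (uncurry (cong₂ _,_) (Finₚ.combine-injective _ _ _ _ eq))
    ... | inj₁ u≡v = u≡v
    ... | inj₂ (inj₁ u~v) = contradiction u~v (indep u∈J v∈J)
    ... | inj₂ (inj₂ (inj₁ Xu)) = contradiction Xu (avoid u∈J)
    ... | inj₂ (inj₂ (inj₂ Xv)) = contradiction Xv (avoid v∈J)

  isHub? : (u : V Δ) → Dec (vh ≡ u)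
  isHub? (vA _ _) = no λ ()
  isHub? (vB _ _) = no λ ()
  isHub? (va _) = no λ ()
  isHub? (vb _) = no λ ()
  isHub? vh = yes refl

  module _ (i₀ : Fin (blocks Δ)) .{{_ : NonZero (Δ ∸ 1)}} where

    classThroughHub : V Δ → Fin (blocks Δ) × Fin (suc (Δ ∸ 1))
    classThroughHub (vA i j) = i , suc j
    classThroughHub (vB i j) = i , suc j
    classThroughHub (va i) = i , zero
    classThroughHub (vb i) = i , zero
    classThroughHub vh = i₀ , zero

    throughHub-cover : CliqueCoverOutside (Adj Δ vh) classThroughHub
    throughHub-cover (va i) _ _ = inj₂ (inj₂ (inj₁ (inj₁ (eha i))))
    throughHub-cover (vb i) _ _ = inj₂ (inj₂ (inj₁ (inj₁ (ehb i))))
    throughHub-cover _ (va i) _ = inj₂ (inj₂ (inj₂ (inj₁ (eha i))))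
    throughHub-cover _ (vb i) _ = inj₂ (inj₂ (inj₂ (inj₁ (ehb i))))
    throughHub-cover (vA i j) (vA _ _) refl = inj₁ refl
    throughHub-cover (vA i j) (vB _ _) refl = inj₂ (inj₁ (inj₁ (eAB i j j)))
    throughHub-cover (vB i j) (vA _ _) refl = inj₂ (inj₁ (inj₂ (eAB i j j)))
    throughHub-cover (vB i j) (vB _ _) refl = inj₁ refl
    throughHub-cover vh vh refl = inj₁ refl
    throughHub-cover (vA _ _) vh ()
    throughHub-cover (vB _ _) vh ()
    throughHub-cover vh (vA _ _) ()
    throughHub-cover vh (vB _ _) ()

    -- Classes {a_i, A_i 0}, {A_i (j+1), B_i j} and {B_i (n-1), b_i}, where n = Δ - 1.
    classAvoidingHub : V Δ → Fin (blocks Δ) × Fin (suc (Δ ∸ 1))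
    classAvoidingHub (vA i j) = i , inject₁ j
    classAvoidingHub (vB i j) = i , suc j
    classAvoidingHub (va i) = i , zero
    classAvoidingHub (vb i) = i , fromℕ (Δ ∸ 1)
    classAvoidingHub vh = i₀ , zero

    avoidingHub-cover : CliqueCoverOutside (_≡ vh) classAvoidingHub
    avoidingHub-cover vh _ _ = inj₂ (inj₂ (inj₁ refl))
    avoidingHub-cover _ vh _ = inj₂ (inj₂ (inj₂ refl))
    avoidingHub-cover (vA i j) (vA _ _) eq =
      inj₁ (cong₂ vA (,-injectiveˡ eq) (Finₚ.inject₁-injective (,-injectiveʳ eq)))
    avoidingHub-cover (vA i j) (vB _ j′) eq with refl ← ,-injectiveˡ eq = inj₂ (inj₁ (inj₁ (eAB i j j′)))
    avoidingHub-cover (vA i j) (va _) eq with refl ← ,-injectiveˡ eq = inj₂ (inj₁ (inj₂ (eaA i j)))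
    avoidingHub-cover (vA i j) (vb _) eq = ⊥-elim (Finₚ.fromℕ≢inject₁ (sym (,-injectiveʳ eq)))
    avoidingHub-cover (vB i j) (vA _ j′) eq with refl ← ,-injectiveˡ eq = inj₂ (inj₁ (inj₂ (eAB i j′ j)))
    avoidingHub-cover (vB i j) (vB _ _) eq =
      inj₁ (cong₂ vB (,-injectiveˡ eq) (Finₚ.suc-injective (,-injectiveʳ eq)))
    avoidingHub-cover (vB i j) (va _) ()
    avoidingHub-cover (vB i j) (vb _) eq with refl ← ,-injectiveˡ eq = inj₂ (inj₁ (inj₂ (ebB i j)))
    avoidingHub-cover (va i) (vA _ j) eq with refl ← ,-injectiveˡ eq = inj₂ (inj₁ (inj₁ (eaA i j)))
    avoidingHub-cover (va i) (vB _ _) ()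
    avoidingHub-cover (va i) (va _) eq = inj₁ (cong va (,-injectiveˡ eq))
    avoidingHub-cover (va i) (vb _) eq = ⊥-elim (zero≢fromℕ (Δ ∸ 1) (,-injectiveʳ eq))
    avoidingHub-cover (vb i) (vA _ _) eq = ⊥-elim (Finₚ.fromℕ≢inject₁ (,-injectiveʳ eq))
    avoidingHub-cover (vb i) (vB _ j) eq with refl ← ,-injectiveˡ eq = inj₂ (inj₁ (inj₁ (ebB i j)))
    avoidingHub-cover (vb i) (va _) eq = ⊥-elim (zero≢fromℕ (Δ ∸ 1) (sym (,-injectiveʳ eq)))
    avoidingHub-cover (vb i) (vb _) eq = inj₁ (cong vb (,-injectiveˡ eq))

    independent-length≤-gadget : ∀ {J} → IsIndependent Δ J → length J ≤ blocks Δ * suc (Δ ∸ 1)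
    independent-length≤-gadget {J} indJ@(_ , indep) with any? isHub? J
    ... | yes vh∈J = independent-length≤ throughHub-cover indJ (indep vh∈J)
    ... | no vh∉J = independent-length≤ avoidingHub-cover indJ λ { u∈J refl → vh∉J u∈J }

lemma2 : (Δ : ℕ) → 1 < Δ → Δ % 2 ≡ 1 →
    Σ (List (V Δ)) (λ I →
    IsMaxIndependent Δ I ×
    length I ≡ ((Δ ∸ 1) * (Δ ∸ 1)) / 2 + (Δ ∸ 1) / 2 ×
    vh ∉ I)
lemma2 Δ 1<Δ odd =
  witness , (witness-independent , maximum) , trans length-witness size , vh∉witness
  where
  open Gadget Δ
  pred≡blocks*2 : Δ ∸ 1 ≡ blocks Δ * 2
  pred≡blocks*2 = odd⇒pred≡blocks*2 Δ odd
  instance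
    pred-nonZero : NonZero (Δ ∸ 1)
    pred-nonZero = ℕ.>-nonZero (ℕₚ.m<n⇒0<n∸m 1<Δ)
  i₀ : Fin (blocks Δ)
  i₀ = fromℕ< (ℕ.>-nonZero⁻¹ (blocks Δ)
    {{ℕₚ.m*n≢0⇒m≢0 (blocks Δ) {{subst NonZero pred≡blocks*2 pred-nonZero}}}})
  maximum : ∀ J → IsIndependent Δ J → length J ≤ length witness
  maximum J indJ = subst (length J ≤_) (sym length-witness) (independent-length≤-gadget i₀ indJ)
  size : blocks Δ * suc (Δ ∸ 1) ≡ (Δ ∸ 1) * (Δ ∸ 1) / 2 + (Δ ∸ 1) / 2
  size = n≡m*2⇒m*[1+n]≡n*n/2+n/2 (blocks Δ) (Δ ∸ 1) pred≡blocks*2
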